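{- Let $G=(X,Y,E)$, $\mathcal{P}_X$, $\mathcal{P}_Y$ be an instance of MIN-REP and let $G'$ be the graph constructed from it as described in the context, with hub set $H$. Then $H$ covers every target couple of $G'$ except those in $[PX,PY]$, i.e., every target couple $[u,v]$ of $G'$ that does not have one vertex in $PX$ and the other in $PY$ is covered by $H$.
   Context: MIN-REP instance: a bipartite graph $G=(X,Y,E)$, a partition $\mathcal{P}_X=\{X_1,\dots,X_{k_X}\}$ of $X$ into sets of size $|X|/k_X$, and a partition $\mathcal{P}_Y=\{Y_1,\dots,Y_{k_Y}\}$ of $Y$ into sets of size $|Y|/k_Y$. $X_i$ and $Y_j$ form a super edge if some vertex of $X_i$ is adjacent in $G$ to some vertex of $Y_j$. Construction of $G'$: start with $G$. For each $X_i$ add two vertices $px^1_i,px^2_i$ and edges $(x,px^1_i),(x,px^2_i)$ for every $x\in X_i$; for each $Y_j$ add two vertices $py^1_j,py^2_j$ and edges $(y,py^1_j),(y,py^2_j)$ for every $y\in Y_j$. For each super edge $(X_i,Y_j)$ add two vertices (relays) $r^1_{i,j},r^2_{i,j}$ and edges $(px^1_i,r^1_{i,j}),(r^1_{i,j},py^1_j),(px^2_i,r^2_{i,j}),(r^2_{i,j},py^2_j)$. Let $PX$ be the set of all $px^I_i$, $PY$ the set of all $py^I_j$, $R$ the set of relays. Add four hubs $h_{X,R},h_{Y,R},h_{PX},h_{PY}$ (the set $H$): $h_{X,R}$ is adjacent to every vertex of $X\cup R$, $h_{Y,R}$ to every vertex of $Y\cup R$, $h_{PX}$ to every vertex of $PX$,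 $h_{PY}$ to every vertex of $PY$, and the hubs form the 4-cycle $(h_{PX},h_{Y,R},h_{PY},h_{X,R},h_{PX})$. Finally, for each hub $h$ add two new vertices (dummy nodes) $d_1,d_2$ and edges $(h,d_1),(h,d_2)$. Covering: for vertices $u,v$ of $G'$, $m_{G'}(u,v)$ is the number of internal vertices on a shortest $u$–$v$ path ($\infty$ if none); for $D\subseteq V(G')$, $m^D(u,v)=m_{G'[D\cup\{u,v\}]}(u,v)$. Vertices $u,v$ form a target couple $[u,v]$ if $m_{G'}(u,v)=1$ (non-adjacent with a common neighbor). $D$ covers $[u,v]$ if $m^D(u,v)\le 2$. A target couple $[a,b]$ is in $[A,B]$ if $a\in A$ and $b\in B$. -}

module Defs where

open import Data.Nat using (ℕ; zero; suc; _≤_)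
open import Data.Fin using (Fin)
open import Data.Fin.Properties using (any?)
open import Data.Bool using (Bool; T)
open import Data.Bool.Properties using (T?)
open import Data.Product using (Σ; ∃; _×_; _,_)
open import Data.Sum using (_⊎_)
open import Relation.Nullary using (¬_)
open import Relation.Nullary.Decidable using (True)
open import Relation.Binary.PropositionalEquality using (_≡_; _≢_)

-- X = ⋃_i X_i with X_i ≅ Fin sX (so |X_i| = |X|/kX),
-- vertex (i , a) is the a-th vertex of X_i; similarly for Y.
record MinRep : Set where
  field
    kX sX kY sY : ℕ
    E : Fin kX → Fin sX → Fin kY → Fin sY → Bool

module Construction (M : MinRep) where
  open MinRep M

  -- X_i and Y_j form a super edge iff some x ∈ X_i is adjacent to some y ∈ Y_j.
  -- (Decided, so that 'SuperEdge i j' is proof-irrelevant: one relay pair per super edge.)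
  SuperEdge : Fin kX → Fin kY → Set
  SuperEdge i j = True (any? (λ a → any? (λ b → T? (E i a j b))))

  data Hub : Set where
    hXR hYR hPX hPY : Hub

  -- Vertices of G'.  'Fin 2' is the superscript I ∈ {1,2}.
  data Vtx : Set where
    vx  : Fin kX → Fin sX → Vtx
    vy  : Fin kY → Fin sY → Vtx
    px  : Fin 2 → Fin kX → Vtx
    py  : Fin 2 → Fin kY → Vtx
    rel : Fin 2 → (i : Fin kX) → (j : Fin kY) → SuperEdge i j → Vtx
    hub : Hub → Vtx
    dum : Hub → Fin 2 → Vtx

  -- Edges of G' (one orientation each; adjacency is the symmetric closure).
  data Edge : Vtx → Vtx → Set where
    eG    : ∀ {i a j b} → T (E i a j b) → Edge (vx i a) (vy j b)
    eXP   : ∀ {i a} I → Edge (vx i a) (px I i)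
    eYP   : ∀ {j b} I → Edge (vy j b) (py I j)
    ePXR  : ∀ {I i j s} → Edge (px I i) (rel I i j s)
    eRPY  : ∀ {I i j s} → Edge (rel I i j s) (py I j)
    eHX   : ∀ {i a} → Edge (hub hXR) (vx i a)
    eHXR  : ∀ {I i j s} → Edge (hub hXR) (rel I i j s)
    eHY   : ∀ {j b} → Edge (hub hYR) (vy j b)
    eHYR  : ∀ {I i j s} → Edge (hub hYR) (rel I i j s)
    eHPX  : ∀ {I i} → Edge (hub hPX) (px I i)
    eHPY  : ∀ {I j} → Edge (hub hPY) (py I j)
    eC1   : Edge (hub hPX) (hub hYR)
    eC2   : Edge (hub hYR) (hub hPY)
    eC3   : Edge (hub hPY) (hub hXR)
    eC4   : Edge (hub hXR) (hub hPX)
    eDum  : ∀ {h} k → Edge (hub h) (dum h k)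

  Adj : Vtx → Vtx → Set
  Adj u v = Edge u v ⊎ Edge v u

  -- Walk P u v n : a u–v walk in G' with exactly n internal vertices,
  -- all of which satisfy P.
  data Walk (P : Vtx → Set) : Vtx → Vtx → ℕ → Set where
    edge : ∀ {u v} → Adj u v → Walk P u v 0
    step : ∀ {u w v n} → Adj u w → P w → Walk P w v n → Walk P u v (suc n)

  -- m_{G'}(u,v) = 1 : u ≠ v, not adjacent, but joined by a path with one internal vertex.
  TargetCouple : Vtx → Vtx → Set
  TargetCouple u v = u ≢ v × ¬ Walk (λ _ → Vtx) u v 0 × Walk (λ _ → Vtx) u v 1

  -- D covers [u,v] : m^D(u,v) ≤ 2, i.e. in G'[D ∪ {u,v}] there is a u–v path with
  -- at most 2 internal vertices.
  Covers : (Vtx → Set) → Vtx → Vtx → Set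
  Covers D u v = ∃ λ n → n ≤ 2 × Walk (λ w → D w ⊎ w ≡ u ⊎ w ≡ v) u v n

  InH : Vtx → Set
  InH w = ∃ λ h → w ≡ hub h

  InPX : Vtx → Set
  InPX w = ∃ λ I → ∃ λ i → w ≡ px I i

  InPY : Vtx → Set
  InPY w = ∃ λ I → ∃ λ j → w ≡ py I j

  InPXPY : Vtx → Vtx → Set
  InPXPY u v = (InPX u × InPY v) ⊎ (InPY u × InPX v)

module Submission where

-- The four hubs form the 4-cycle hPX – hYR – hPY – hXR – hPX, so two
-- hubs are either "close" (equal or consecutive) or antipodal.  If u is adjacent to
-- a hub h₁, v to a hub h₂ and h₁, h₂ are close, then u–h₁–v or u–h₁–h₂–v is a path
-- with at most two internal vertices, all hubs; we then call u, v "linked", and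
-- linked vertices are covered by H.
-- Every vertex has a hub neighbour.  Relays and hubs are adjacent to two antipodal
-- hubs; since every hub is close to one of any two antipodal hubs, such "universal"
-- vertices are linked to every vertex.  All other vertices (x, y, px, py, dummies)
-- are "plain": they have exactly one hub neighbour, their anchor.  A case analysis
-- of the common neighbour w of two plain vertices at distance two shows that their
-- anchors are close, except when one lies in PX and the other in PY.  Hence the two
-- endpoints of every target couple outside [PX,PY] are linked, and so covered.

open import Defs
open import Relation.Nullary using (¬_)
open import Data.Nat using (s≤s; z≤n)
open import Data.Product using (∃; ∃₂; _×_; _,_; proj₂)
open import Data.Sum using (_⊎_; inj₁; inj₂; swap)
open import Data.Empty using (⊥-elim)
open import Relation.Binary.PropositionalEquality using (_≡_; refl; sym; subst₂)

module HubCover (M : MinRep) where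
  open Construction M

  adj-sym : ∀ {u v} → Adj u v → Adj v u
  adj-sym = swap

  data Close : Hub → Hub → Set where
    same : ∀ {h} → Close h h
    next : ∀ {h₁ h₂} → Adj (hub h₁) (hub h₂) → Close h₁ h₂

  close-sym : ∀ {h₁ h₂} → Close h₁ h₂ → Close h₂ h₁
  close-sym same     = same
  close-sym (next a) = next (adj-sym a)

  data Antipodal : Hub → Hub → Set where
    xr-yr : Antipodal hXR hYR
    px-py : Antipodal hPX hPY

  antipodal-cover : ∀ {h₁ h₂} → Antipodal h₁ h₂ → ∀ h → Close h₁ h ⊎ Close h₂ h
  antipodal-cover xr-yr hXR = inj₁ same
  antipodal-cover xr-yr hYR = inj₂ same
  antipodal-cover xr-yr hPX = inj₁ (next (inj₁ eC4))
  antipodal-cover xr-yr hPY = inj₁ (next (inj₂ eC3))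
  antipodal-cover px-py hXR = inj₁ (next (inj₂ eC4))
  antipodal-cover px-py hYR = inj₁ (next (inj₁ eC1))
  antipodal-cover px-py hPX = inj₁ same
  antipodal-cover px-py hPY = inj₂ same

  Linked : Vtx → Vtx → Set
  Linked u v = ∃₂ λ h₁ h₂ → Adj u (hub h₁) × Close h₁ h₂ × Adj (hub h₂) v

  linked-sym : ∀ {u v} → Linked u v → Linked v u
  linked-sym (h₁ , h₂ , a , c , b) = h₂ , h₁ , adj-sym b , close-sym c , adj-sym a

  linked-covers : ∀ {u v} → Linked u v → Covers InH u v
  linked-covers (h₁ , _ , a , same , b) =
    1 , s≤s z≤n , step a (inj₁ (h₁ , refl)) (edge b)
  linked-covers (h₁ , h₂ , a , next c , b) =
    2 , s≤s (s≤s z≤n) , step a (inj₁ (h₁ , refl)) (step c (inj₁ (h₂ , refl)) (edge b))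

  data Universal (u : Vtx) : Set where
    universal : ∀ {h₁ h₂} → Antipodal h₁ h₂ → Adj u (hub h₁) → Adj u (hub h₂) → Universal u

  universal-linked : ∀ {u v h} → Universal u → Adj (hub h) v → Linked u v
  universal-linked {h = h} (universal {h₁} {h₂} p a₁ a₂) b with antipodal-cover p h
  ... | inj₁ c = h₁ , h , a₁ , c , b
  ... | inj₂ c = h₂ , h , a₂ , c , b

  data Plain : Vtx → Set where
    plain-x  : ∀ {i a} → Plain (vx i a)
    plain-y  : ∀ {j b} → Plain (vy j b)
    plain-px : ∀ {I i} → Plain (px I i)
    plain-py : ∀ {I j} → Plain (py I j)
    plain-d  : ∀ {h k} → Plain (dum h k)

  anchor : ∀ {u} → Plain u → Hub
  anchor plain-x          = hXR
  anchor plain-y          = hYR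
  anchor plain-px         = hPX
  anchor plain-py         = hPY
  anchor (plain-d {h}) = h

  anchor-adj : ∀ {u} (p : Plain u) → Adj (hub (anchor p)) u
  anchor-adj plain-x  = inj₁ eHX
  anchor-adj plain-y  = inj₁ eHY
  anchor-adj plain-px = inj₁ eHPX
  anchor-adj plain-py = inj₁ eHPY
  anchor-adj plain-d  = inj₁ (eDum _)

  anchor-unique : ∀ {u h} (p : Plain u) → Adj u (hub h) → anchor p ≡ h
  anchor-unique plain-x  (inj₂ eHX)       = refl
  anchor-unique plain-y  (inj₂ eHY)       = refl
  anchor-unique plain-px (inj₂ eHPX)      = refl
  anchor-unique plain-py (inj₂ eHPY)      = refl
  anchor-unique plain-d  (inj₂ (eDum _)) = refl

  classify : ∀ u → Universal u ⊎ Plain u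
  classify (vx _ _)      = inj₂ plain-x
  classify (vy _ _)      = inj₂ plain-y
  classify (px _ _)      = inj₂ plain-px
  classify (py _ _)      = inj₂ plain-py
  classify (rel _ _ _ _) = inj₁ (universal xr-yr (inj₂ eHXR) (inj₂ eHYR))
  classify (hub hXR)     = inj₁ (universal px-py (inj₁ eC4) (inj₂ eC3))
  classify (hub hYR)     = inj₁ (universal px-py (inj₂ eC1) (inj₁ eC2))
  classify (hub hPX)     = inj₁ (universal xr-yr (inj₂ eC4) (inj₁ eC1))
  classify (hub hPY)     = inj₁ (universal xr-yr (inj₁ eC3) (inj₂ eC2))
  classify (dum _ _)     = inj₂ plain-d

  common-hub : ∀ {u v h} (p : Plain u) (q : Plain v) → Adj u (hub h) → Adj (hub h) v →
               Close (anchor p) (anchor q)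
  common-hub p q a b =
    subst₂ Close (sym (anchor-unique p a)) (sym (anchor-unique q (adj-sym b))) same

  -- The absurd
  -- clauses are the walks whose far endpoint would be a relay or a hub.
  plain-close : ∀ {u w v} (p : Plain u) → Adj u w → Adj w v → (q : Plain v) →
                ¬ InPXPY u v → Close (anchor p) (anchor q)
  plain-close plain-x  (inj₁ (eG _))  (inj₂ (eG _))  plain-x  _ = same
  plain-close plain-x  (inj₁ (eG _))  (inj₁ (eYP _)) plain-py _ = next (inj₂ eC3)
  plain-close plain-x  (inj₁ (eG _))  (inj₂ eHY)     ()       _
  plain-close plain-x  (inj₁ (eXP _)) (inj₂ (eXP _)) plain-x  _ = same
  plain-close plain-x  (inj₁ (eXP _)) (inj₁ ePXR)    ()       _
  plain-close plain-x  (inj₁ (eXP _)) (inj₂ eHPX)    ()       _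
  plain-close p@plain-x  a@(inj₂ eHX)       b q _ = common-hub p q a b
  plain-close plain-y  (inj₂ (eG _))  (inj₁ (eG _))  plain-y  _ = same
  plain-close plain-y  (inj₂ (eG _))  (inj₁ (eXP _)) plain-px _ = next (inj₂ eC1)
  plain-close plain-y  (inj₂ (eG _))  (inj₂ eHX)     ()       _
  plain-close plain-y  (inj₁ (eYP _)) (inj₂ (eYP _)) plain-y  _ = same
  plain-close plain-y  (inj₁ (eYP _)) (inj₂ eRPY)    ()       _
  plain-close plain-y  (inj₁ (eYP _)) (inj₂ eHPY)    ()       _
  plain-close p@plain-y  a@(inj₂ eHY)       b q _ = common-hub p q a b
  plain-close plain-px (inj₂ (eXP _)) (inj₁ (eG _))  plain-y  _ = next (inj₁ eC1)
  plain-close plain-px (inj₂ (eXP _)) (inj₁ (eXP _)) plain-px _ = same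
  plain-close plain-px (inj₂ (eXP _)) (inj₂ eHX)     ()       _
  plain-close plain-px (inj₁ ePXR)    (inj₂ ePXR)    plain-px _ = same
  plain-close plain-px (inj₁ ePXR)    (inj₁ eRPY)    plain-py np =
    ⊥-elim (np (inj₁ ((_ , _ , refl) , (_ , _ , refl))))
  plain-close p@plain-px a@(inj₂ eHPX)      b q _ = common-hub p q a b
  plain-close plain-py (inj₂ (eYP _)) (inj₂ (eG _))  plain-x  _ = next (inj₁ eC3)
  plain-close plain-py (inj₂ (eYP _)) (inj₁ (eYP _)) plain-py _ = same
  plain-close plain-py (inj₂ eRPY)    (inj₂ ePXR)    plain-px np =
    ⊥-elim (np (inj₂ ((_ , _ , refl) , (_ , _ , refl))))
  plain-close plain-py (inj₂ eRPY)    (inj₁ eRPY)    plain-py _ = same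
  plain-close p@plain-py a@(inj₂ eHPY)      b q _ = common-hub p q a b
  plain-close p@plain-d  a@(inj₂ (eDum _)) b q _ = common-hub p q a b

  hub-neighbour : ∀ v → ∃ λ h → Adj (hub h) v
  hub-neighbour v with classify v
  ... | inj₁ (universal _ a _) = _ , adj-sym a
  ... | inj₂ p                 = anchor p , anchor-adj p

  two-step-linked : ∀ {u w v} → Adj u w → Adj w v → ¬ InPXPY u v → Linked u v
  two-step-linked {u} {v = v} a b np with classify u | classify v
  ... | inj₁ U | _      = universal-linked U (proj₂ (hub-neighbour v))
  ... | inj₂ p | inj₁ V = linked-sym (universal-linked V (anchor-adj p))
  ... | inj₂ p | inj₂ q =
    anchor p , anchor q , adj-sym (anchor-adj p) , plain-close p a b q np , anchor-adj q

lemma6 : (M : MinRep) → let open Construction M in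
    ∀ u v → TargetCouple u v → ¬ InPXPY u v → Covers InH u v
lemma6 M u v (_ , _ , Construction.step a _ (Construction.edge b)) np =
  HubCover.linked-covers M (HubCover.two-step-linked M a b np)
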